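{- Let $w\in S_n$ and let the Rothe diagram $D(w)$ have columns $D_1,\ldots,D_n$. Then $w$ is fireworks if and only if for every $j\in[n]$, $D_{w(j)}\neq\emptyset$ implies $\max(D_{w(j)})=j-1$.
   Context: Permutations are written in one-line notation. The Rothe diagram of $w\in S_n$ is $D(w)=\{(i,j)\in[n]\times[n]: i<w^{ -1}(j)\text{ and } j<w(i)\}$ and its $k$th column is $D_k=\{i:(i,k)\in D(w)\}$. The decreasing runs of $w$ are the maximal blocks of consecutive positions on which $w(1)w(2)\cdots w(n)$ is decreasing; $w$ is called fireworks if the initial (first) elements of its decreasing runs occur in increasing order (e.g. $267419853$ has runs $2|6|741|9853$ and is fireworks). -}

module Defs where

open import Data.Nat using (ℕ; suc)
open import Data.Fin using (Fin; toℕ; _<_; _≤_)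
open import Data.Fin.Permutation using (Permutation′; _⟨$⟩ʳ_; _⟨$⟩ˡ_)
open import Data.Product using (Σ; _×_; ∃)
open import Data.Sum using (_⊎_)
open import Relation.Binary.PropositionalEquality using (_≡_)

-- Convention: [n] is represented 0-indexed by Fin n; w ⟨$⟩ʳ i is w(i),
-- w ⟨$⟩ˡ j is w⁻¹(j).

InRothe : ∀ {n} → Permutation′ n → Fin n → Fin n → Set
InRothe w i k = (i < (w ⟨$⟩ˡ k)) × (k < (w ⟨$⟩ʳ i))

ColumnNonempty : ∀ {n} → Permutation′ n → Fin n → Set
ColumnNonempty w k = ∃ λ i → InRothe w i k

IsColumnMax : ∀ {n} → Permutation′ n → Fin n → Fin n → Set
IsColumnMax w k m = InRothe w m k × (∀ i → InRothe w i k → i ≤ m)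

IsRunStart : ∀ {n} → Permutation′ n → Fin n → Set
IsRunStart w i = (toℕ i ≡ 0) ⊎ (∃ λ p → (suc (toℕ p) ≡ toℕ i) × ((w ⟨$⟩ʳ p) < (w ⟨$⟩ʳ i)))

IsFireworks : ∀ {n} → Permutation′ n → Set
IsFireworks w = ∀ i i' → IsRunStart w i → IsRunStart w i' → i < i' →
  (w ⟨$⟩ʳ i) < (w ⟨$⟩ʳ i')

{-# OPTIONS --safe #-}
module Submission where

open import Defs
open import Data.Nat using (ℕ; suc)
import Data.Nat.Properties as ℕ
open import Data.Fin using (Fin; zero; suc; toℕ; inject₁; _<_; _≤_)
open import Data.Fin.Properties using (toℕ-inject₁; toℕ-injective; <-cmp; <-asym; <-irrefl)
open import Data.Fin.Induction using (<-wellFounded)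
open import Data.Fin.Permutation using (Permutation′; _⟨$⟩ʳ_; _⟨$⟩ˡ_; inverseˡ)
open import Data.Product using (∃; _×_; _,_; proj₁; proj₂)
open import Data.Sum using (_⊎_; inj₁; inj₂)
open import Data.Empty using (⊥-elim)
open import Function.Bundles using (_⇔_; mk⇔; module Equivalence)
open import Induction.WellFounded using (Acc; acc)
open import Relation.Binary using (tri<; tri≈; tri>)
open import Relation.Binary.PropositionalEquality using (_≡_; _≢_; refl; sym; trans; cong)

open Equivalence using (to; from)

-- Fireworks means every run start exceeds all earlier entries, since each
-- earlier entry is bounded by the start of its own run.  Then D_{w(j)} is
-- {i < j : w(i) > w(j)}: if it is nonempty, j is no run start, so w(j-1) > w(j)
-- and j - 1 is its maximum.  Conversely, if run starts i < j had w(i) > w(j),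
-- then i ∈ D_{w(j)} with maximum j - 1, i.e. w(j-1) > w(j), so j would not
-- start a run.

<⇒≤pred : ∀ {n} {i j p : Fin n} → suc (toℕ p) ≡ toℕ j → i < j → i ≤ p
<⇒≤pred sp≡j i<j = ℕ.≤-pred (ℕ.≤-trans i<j (ℕ.≤-reflexive (sym sp≡j)))

pred-unique : ∀ {n} {p q j : Fin n} → suc (toℕ p) ≡ toℕ j → suc (toℕ q) ≡ toℕ j → p ≡ q
pred-unique sp≡j sq≡j = toℕ-injective (ℕ.suc-injective (trans sp≡j (sym sq≡j)))

inject₁≢suc : ∀ {n} (i : Fin n) → inject₁ i ≢ suc i
inject₁≢suc i eq = ℕ.1+n≢n (trans (sym (cong toℕ eq)) (toℕ-inject₁ i))

module _ {n : ℕ} (w : Permutation′ n) where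

  permutation-injective : ∀ {i j} → w ⟨$⟩ʳ i ≡ w ⟨$⟩ʳ j → i ≡ j
  permutation-injective {i} {j} wi≡wj =
    trans (sym (inverseˡ w)) (trans (cong (w ⟨$⟩ˡ_) wi≡wj) (inverseˡ w))

  inRothe-image⇔ : ∀ i j → InRothe w i (w ⟨$⟩ʳ j) ⇔ (i < j × w ⟨$⟩ʳ j < w ⟨$⟩ʳ i)
  inRothe-image⇔ i j rewrite inverseˡ w {j} = mk⇔ (λ x → x) (λ x → x)

  IsDescentAt : Fin n → Set
  IsDescentAt i = ∃ λ p → (suc (toℕ p) ≡ toℕ i) × (w ⟨$⟩ʳ i < w ⟨$⟩ʳ p)

  runStart⊎descent : ∀ i → IsRunStart w i ⊎ IsDescentAt i
  runStart⊎descent zero = inj₁ (inj₁ refl)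
  runStart⊎descent (suc i) with <-cmp (w ⟨$⟩ʳ inject₁ i) (w ⟨$⟩ʳ suc i)
  ... | tri< ascent _ _ = inj₁ (inj₂ (inject₁ i , cong suc (toℕ-inject₁ i) , ascent))
  ... | tri≈ _ eq _ = ⊥-elim (inject₁≢suc i (permutation-injective eq))
  ... | tri> _ _ descent = inj₂ (inject₁ i , cong suc (toℕ-inject₁ i) , descent)

  runStart-above : ∀ i → Acc _<_ i → ∃ λ s → IsRunStart w s × s ≤ i × w ⟨$⟩ʳ i ≤ w ⟨$⟩ʳ s
  runStart-above i (acc rec) with runStart⊎descent i
  ... | inj₁ start = i , start , ℕ.≤-refl , ℕ.≤-refl
  ... | inj₂ (p , sp≡i , wi<wp) with runStart-above p (rec (ℕ.≤-reflexive sp≡i))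
  ...   | s , start , s≤p , wp≤ws =
    s , start , ℕ.≤-trans s≤p (ℕ.<⇒≤ (ℕ.≤-reflexive sp≡i)) , ℕ.≤-trans (ℕ.<⇒≤ wi<wp) wp≤ws

  fireworks⇒runStart-exceeds-prefix : IsFireworks w →
    ∀ {i j} → IsRunStart w j → i < j → w ⟨$⟩ʳ i < w ⟨$⟩ʳ j
  fireworks⇒runStart-exceeds-prefix fireworks {i} start-j i<j
    with runStart-above i (<-wellFounded i)
  ... | s , start-s , s≤i , wi≤ws =
    ℕ.≤-<-trans wi≤ws (fireworks s _ start-s start-j (ℕ.≤-<-trans s≤i i<j))

  ColumnMaxIsPred : Set
  ColumnMaxIsPred = ∀ (j : Fin n) → ColumnNonempty w (w ⟨$⟩ʳ j) →
    ∃ λ m → IsColumnMax w (w ⟨$⟩ʳ j) m × (suc (toℕ m) ≡ toℕ j)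

  fireworks⇒columnMaxIsPred : IsFireworks w → ColumnMaxIsPred
  fireworks⇒columnMaxIsPred fireworks j (i , i∈D)
    with to (inRothe-image⇔ i j) i∈D | runStart⊎descent j
  ... | i<j , wj<wi | inj₁ start =
    ⊥-elim (<-asym wj<wi (fireworks⇒runStart-exceeds-prefix fireworks start i<j))
  ... | i<j , _ | inj₂ (p , sp≡j , wj<wp) =
    p , (from (inRothe-image⇔ p j) (ℕ.≤-reflexive sp≡j , wj<wp) , below-p) , sp≡j
    where
    below-p : ∀ i' → InRothe w i' (w ⟨$⟩ʳ j) → i' ≤ p
    below-p i' i'∈D = <⇒≤pred sp≡j (proj₁ (to (inRothe-image⇔ i' j) i'∈D))

  columnMaxIsPred⇒fireworks : ColumnMaxIsPred → IsFireworks w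
  columnMaxIsPred⇒fireworks columnMax i j _ start-j i<j
    with <-cmp (w ⟨$⟩ʳ i) (w ⟨$⟩ʳ j)
  ... | tri< wi<wj _ _ = wi<wj
  ... | tri≈ _ wi≡wj _ = ⊥-elim (<-irrefl (permutation-injective wi≡wj) i<j)
  ... | tri> _ _ wj<wi
    with columnMax j (i , from (inRothe-image⇔ i j) (i<j , wj<wi)) | start-j
  ...   | m , _ , sm≡j | inj₁ j≡0 = ⊥-elim (ℕ.1+n≢0 (trans sm≡j j≡0))
  ...   | m , (m∈D , _) , sm≡j | inj₂ (p , sp≡j , wp<wj)
    with refl ← pred-unique sp≡j sm≡j =
      ⊥-elim (<-asym (proj₂ (to (inRothe-image⇔ m j) m∈D)) wp<wj)

proposition3p9 : (n : ℕ) (w : Permutation′ n) →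
    IsFireworks w ⇔ (∀ (j : Fin n) → ColumnNonempty w (w ⟨$⟩ʳ j) →
    ∃ λ m → IsColumnMax w (w ⟨$⟩ʳ j) m × (suc (toℕ m) ≡ toℕ j))
proposition3p9 n w = mk⇔ (fireworks⇒columnMaxIsPred w) (columnMaxIsPred⇒fireworks w)
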